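{- Let $p$ be an odd prime, $q$ a power of $p$, $l\ge 0$ an integer, and $k=2$. Then $D_{p^l+2,k}(1,x)$ is a permutation polynomial of $\mathbb{F}_q$ if and only if $l=0$.
   Context: For an integer $k$ with $0\le k\le p-1$ and an integer $n\ge1$, $D_{n,k}(1,x)=\sum_{i=0}^{\lfloor n/2\rfloor}\frac{n-ki}{n-i}\binom{n-i}{i}(-x)^i\in\mathbb{F}_q[x]$ (the coefficients are integers, reduced mod $p$). A permutation polynomial of $\mathbb{F}_q$ is a polynomial inducing a bijection of $\mathbb{F}_q$. -}

module Defs where

open import Level using (Level; _⊔_) renaming (suc to lsuc)
open import Data.Nat as ℕ using (ℕ; zero; suc; _∸_; ⌊_/2⌋)
open import Data.Nat.Combinatorics using (_C_)
open import Data.Integer as ℤ using (ℤ; +_; -[1+_]; _/ℕ_)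
open import Data.Fin using (Fin)
open import Data.Product using (∃)
open import Relation.Nullary using (¬_)
open import Relation.Binary.PropositionalEquality as ≡ using (_≡_)
open import Algebra.Bundles using (CommutativeRing)
open import Function.Bundles using (Bijection)
open import Function.Definitions using (Bijective)

record FiniteField (c ℓ : Level) (q : ℕ) : Set (lsuc (c ⊔ ℓ)) where
  field
    cring    : CommutativeRing c ℓ
  open CommutativeRing cring public
  field
    1≉0      : ¬ (1# ≈ 0#)
    inverse  : ∀ x → ¬ (x ≈ 0#) → ∃ λ y → (x * y) ≈ 1#
    enum     : Bijection (≡.setoid (Fin q)) setoid

-- Integer coefficient  (n - k i)/(n - i) * binom(n - i, i)  of D_{n,k}(1,x).
-- The division is exact in the range 0 ≤ i ≤ ⌊n/2⌋, n ≥ 1; there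
-- n - i ≥ 1, so n - i = suc (n ∸ i ∸ 1), which is the divisor used.
Dcoeff : ℕ → ℕ → ℕ → ℤ
Dcoeff n k i =
  ((+ n ℤ.- + (k ℕ.* i)) ℤ.* + ((n ∸ i) C i)) /ℕ suc (n ∸ i ∸ 1)

module _ {c ℓ q} (F : FiniteField c ℓ q) where
  open FiniteField F

  ℕ→F : ℕ → Carrier
  ℕ→F zero    = 0#
  ℕ→F (suc m) = 1# + ℕ→F m

  ℤ→F : ℤ → Carrier
  ℤ→F (+ m)      = ℕ→F m
  ℤ→F -[1+ m ]   = - ℕ→F (suc m)

  pow : Carrier → ℕ → Carrier
  pow a zero    = 1#
  pow a (suc m) = a * pow a m

  sumTo : ℕ → (ℕ → Carrier) → Carrier
  sumTo zero    f = f 0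
  sumTo (suc m) f = sumTo m f + f (suc m)

  D : ℕ → ℕ → Carrier → Carrier
  D n k x = sumTo ⌊ n /2⌋ (λ i → ℤ→F (Dcoeff n k i) * pow (- x) i)

  IsPermutationPolynomial : (Carrier → Carrier) → Set (c ⊔ ℓ)
  IsPermutationPolynomial f = Bijective _≈_ _≈_ f

{-# OPTIONS --safe #-}
-- D_{n,2}(1,x) is the Dickson polynomial of the second kind E_{n-1}(1,x), since
-- ((n-2i)/(n-i)) C(n-i,i) = C(n-1-i,i), and E_{m+2} = E_{m+1} - x E_m.  For l = 0 this is
-- D_{3,2}(1,x) = 1 - x, an involution.  For l ≥ 1 and N = p^l, both x = 1/4 and x = 1/2 are
-- sent to 1/2.  At x = 1/4 the recurrence has the double root 1/2, so
-- E_{N+1} = (N+2)/2^{N+1} = 1/2 because N · 1 = 0 and 2^N = 2 in F.  At x = 1/2 its roots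
-- y, z = (1 ± i)/2 lie in F[i], where the Frobenius power x ↦ x^N fixes or swaps them;
-- either way E_{N+1} = (y^{N+2} - z^{N+2})/(y - z) = yz = 1/2.
module Submission where

open import Defs
open import Algebra.Bundles using (CommutativeRing)
import Algebra.Properties.Semiring.Mult as Mult
import Data.Nat as ℕ
open import Data.Nat.Primality using (Prime)
open import Relation.Nullary using (¬_)
open import Relation.Binary.PropositionalEquality using (_≡_)

module Parity where
  open import Data.Nat
  open import Data.Nat.Properties
  open import Data.Nat.Divisibility using (divides)
  open import Data.Nat.Primality using (prime⇒irreducible)
  open import Data.Product using (∃-syntax; _,_)
  open import Data.Sum using (_⊎_; inj₁; inj₂)
  open import Data.Empty using (⊥-elim)
  open import Relation.Binary.PropositionalEquality

  even⊎odd : ∀ n → ∃[ r ] (n ≡ r + r ⊎ n ≡ suc (r + r))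
  even⊎odd zero = 0 , inj₁ refl
  even⊎odd (suc n) with even⊎odd n
  ... | r , inj₁ n≡2r   = r , inj₂ (cong suc n≡2r)
  ... | r , inj₂ n≡2r+1 = suc r , inj₁ (trans (cong suc n≡2r+1) (cong suc (sym (+-suc r r))))

  r+r≡r*2 : ∀ r → r + r ≡ r * 2
  r+r≡r*2 r = trans (cong (λ t → r + t) (sym (+-identityʳ r))) (*-comm 2 r)

  odd-prime : ∀ {p} → Prime p → ¬ p ≡ 2 → ∃[ r ] p ≡ suc (r + r)
  odd-prime {p} p-prime p≢2 with even⊎odd p
  ... | r , inj₂ p≡2r+1 = r , p≡2r+1
  ... | r , inj₁ p≡2r with prime⇒irreducible p-prime (divides r (trans p≡2r (r+r≡r*2 r)))
  ...   | inj₁ ()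
  ...   | inj₂ 2≡p = ⊥-elim (p≢2 (sym 2≡p))

  i≤⌊n/2⌋⇒i+i≤n : ∀ n i → i ≤ ⌊ n /2⌋ → i + i ≤ n
  i≤⌊n/2⌋⇒i+i≤n n             zero    _         = z≤n
  i≤⌊n/2⌋⇒i+i≤n (suc (suc n)) (suc i) (s≤s i≤) =
    s≤s (subst (_≤ suc n) (sym (+-suc i i)) (s≤s (i≤⌊n/2⌋⇒i+i≤n n i i≤)))

  ⌊n/2⌋<i⇒n<i+i : ∀ n i → ⌊ n /2⌋ < i → n < i + i
  ⌊n/2⌋<i⇒n<i+i zero          (suc i) _         = z<s
  ⌊n/2⌋<i⇒n<i+i (suc zero)    (suc i) _         = s≤s (subst (1 ≤_) (sym (+-suc i i)) (s≤s z≤n))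
  ⌊n/2⌋<i⇒n<i+i (suc (suc n)) (suc i) (s≤s <i) =
    s≤s (subst (suc n <_) (sym (+-suc i i)) (s≤s (⌊n/2⌋<i⇒n<i+i n i <i)))

  i+i≤1+m⇒i≤m : ∀ {m} i → i + i ≤ suc m → i ≤ m
  i+i≤1+m⇒i≤m zero    _         = z≤n
  i+i≤1+m⇒i≤m (suc i) (s≤s 2i≤) = m+n≤o⇒n≤o i 2i≤

module Binomial where
  open import Data.Nat
  open import Data.Nat.Properties
  open import Data.Nat.Combinatorics using (_C_; nCk+nC[k+1]≡[n+1]C[k+1]; nC1≡n; k>n⇒nCk≡0)
  open import Data.Nat.Divisibility using (_∣_; divides; ∣⇒≤)
  open import Data.Nat.Primality using (euclidsLemma)
  open import Data.Nat.Solver using (module +-*-Solver)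
  open import Data.Sum using (inj₁; inj₂)
  open import Data.Empty using (⊥-elim)
  open import Relation.Nullary using (yes; no)
  open import Relation.Binary.PropositionalEquality
  open +-*-Solver using (solve; _:+_; _:*_; _:=_; con)
  open ≡-Reasoning

  [1+k]*[1+n]C[1+k]≡[1+n]*nCk : ∀ n k → suc k * (suc n C suc k) ≡ suc n * (n C k)
  [1+k]*[1+n]C[1+k]≡[1+n]*nCk zero    zero    = refl
  [1+k]*[1+n]C[1+k]≡[1+n]*nCk zero    (suc k) = *-zeroʳ (suc (suc k))
  [1+k]*[1+n]C[1+k]≡[1+n]*nCk (suc n) zero    = begin
    1 * (suc (suc n) C 1) ≡⟨ *-identityˡ _ ⟩
    suc (suc n) C 1       ≡⟨ nC1≡n (suc (suc n)) ⟩
    suc (suc n)           ≡⟨ *-identityʳ (suc (suc n)) ⟨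
    suc (suc n) * 1       ∎
  [1+k]*[1+n]C[1+k]≡[1+n]*nCk (suc n) (suc k) = begin
    suc (suc k) * (suc (suc n) C suc (suc k))
      ≡⟨ cong (suc (suc k) *_) (nCk+nC[k+1]≡[n+1]C[k+1] (suc n) (suc k)) ⟨
    suc (suc k) * (A + B)
      ≡⟨ solve 3 (λ k A B → (con 2 :+ k) :* (A :+ B) := A :+ ((con 1 :+ k) :* A :+ (con 2 :+ k) :* B)) refl k A B ⟩
    A + (suc k * A + suc (suc k) * B)
      ≡⟨ cong₂ (λ u v → A + (u + v)) ([1+k]*[1+n]C[1+k]≡[1+n]*nCk n k) ([1+k]*[1+n]C[1+k]≡[1+n]*nCk n (suc k)) ⟩
    A + (suc n * (n C k) + suc n * (n C suc k))
      ≡⟨ cong (A +_) (*-distribˡ-+ (suc n) (n C k) (n C suc k)) ⟨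
    A + suc n * (n C k + n C suc k)
      ≡⟨ cong (λ u → A + suc n * u) (nCk+nC[k+1]≡[n+1]C[k+1] n k) ⟩
    A + suc n * A
      ∎
    where
    A = suc n C suc k
    B = suc n C suc (suc k)

  [1+n∸k]*[1+n]Ck≡[1+n]*nCk : ∀ n k → (suc n ∸ k) * (suc n C k) ≡ suc n * (n C k)
  [1+n∸k]*[1+n]Ck≡[1+n]*nCk n zero    = refl
  [1+n∸k]*[1+n]Ck≡[1+n]*nCk n (suc j) with j ≤? n
  ... | yes j≤n = +-cancelˡ-≡ (suc j * c) _ _ (begin
    suc j * c + (n ∸ j) * c                ≡⟨ *-distribʳ-+ c (suc j) (n ∸ j) ⟨
    (suc j + (n ∸ j)) * c                  ≡⟨ cong (_* c) (m+[n∸m]≡n (s≤s j≤n)) ⟩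
    suc n * c                              ≡⟨ cong (suc n *_) (nCk+nC[k+1]≡[n+1]C[k+1] n j) ⟨
    suc n * (n C j + n C suc j)            ≡⟨ *-distribˡ-+ (suc n) (n C j) (n C suc j) ⟩
    suc n * (n C j) + suc n * (n C suc j)  ≡⟨ cong (_+ suc n * (n C suc j)) ([1+k]*[1+n]C[1+k]≡[1+n]*nCk n j) ⟨
    suc j * c + suc n * (n C suc j)        ∎)
    where c = suc n C suc j
  ... | no j≰n = begin
    (n ∸ j) * (suc n C suc j) ≡⟨ cong (_* (suc n C suc j)) (m≤n⇒m∸n≡0 (<⇒≤ (≰⇒> j≰n))) ⟩
    0                         ≡⟨ *-zeroʳ (suc n) ⟨
    suc n * 0                 ≡⟨ cong (suc n *_) (k>n⇒nCk≡0 (m<n⇒m<1+n (≰⇒> j≰n))) ⟨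
    suc n * (n C suc j)       ∎

  prime∣pCk : ∀ {p k} → Prime p → 0 < k → k < p → p ∣ p C k
  prime∣pCk {suc n} {suc k} p-prime _ k<p
    with euclidsLemma (suc k) (suc n C suc k) p-prime
           (divides (n C k) (trans ([1+k]*[1+n]C[1+k]≡[1+n]*nCk n k) (*-comm (suc n) (n C k))))
  ... | inj₂ p∣pCk = p∣pCk
  ... | inj₁ p∣k   = ⊥-elim (<⇒≱ k<p (∣⇒≤ p∣k))

  [m∸i]Ci≡0 : ∀ m i → m < i + i → (m ∸ i) C i ≡ 0
  [m∸i]Ci≡0 m zero    ()
  [m∸i]Ci≡0 m (suc i) m<2i = k>n⇒nCk≡0 (m<n+o⇒m∸n<o m (suc i) m<2i)

  [1+m∸i]C[1+i]≡[m∸i]Ci+[m∸i]C[1+i] : ∀ m i → (suc m ∸ i) C suc i ≡ (m ∸ i) C i + (m ∸ i) C suc i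
  [1+m∸i]C[1+i]≡[m∸i]Ci+[m∸i]C[1+i] m i with i ≤? m
  ... | yes i≤m = trans (cong (_C suc i) (+-∸-assoc 1 i≤m)) (sym (nCk+nC[k+1]≡[n+1]C[k+1] (m ∸ i) i))
  ... | no  i≰m with ≰⇒> i≰m
  ... | s≤s m≤j rewrite m≤n⇒m∸n≡0 m≤j | m≤n⇒m∸n≡0 (m≤n⇒m≤1+n m≤j) = refl

module DicksonCoefficient where
  open import Data.Nat
  open import Data.Nat.Properties
  open import Data.Nat.DivMod using (_/_; m*n/n≡m)
  open import Data.Nat.Combinatorics using (_C_)
  open import Data.Integer as ℤ using (ℤ; +_; _⊖_; _/ℕ_)
  open import Data.Integer.Properties using ([+m]-[+n]≡m⊖n; ⊖-≥; pos-*)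
  open import Relation.Binary.PropositionalEquality
  open Parity using (i+i≤1+m⇒i≤m)
  open Binomial using ([1+n∸k]*[1+n]Ck≡[1+n]*nCk)
  open ≡-Reasoning

  Dcoeff[1+m,2,i]≡[m∸i]Ci : ∀ m i → i + i ≤ suc m → Dcoeff (suc m) 2 i ≡ + ((m ∸ i) C i)
  Dcoeff[1+m,2,i]≡[m∸i]Ci m i 2i≤1+m = begin
    Dcoeff (suc m) 2 i                     ≡⟨ cong (λ t → (t ℤ.* + ((suc m ∸ i) C i)) /ℕ suc (suc m ∸ i ∸ 1)) numerator ⟩
    quotient (suc m ∸ i)                   ≡⟨ cong quotient (+-∸-assoc 1 (i+i≤1+m⇒i≤m i 2i≤1+m)) ⟩
    quotient (suc a)                       ≡⟨ cong (_/ℕ suc a) (pos-* (suc a ∸ i) (suc a C i)) ⟨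
    + ((suc a ∸ i) * (suc a C i) / suc a)  ≡⟨ cong (λ t → + (t / suc a)) ([1+n∸k]*[1+n]Ck≡[1+n]*nCk a i) ⟩
    + (suc a * (a C i) / suc a)            ≡⟨ cong (λ t → + (t / suc a)) (*-comm (suc a) (a C i)) ⟩
    + ((a C i) * suc a / suc a)            ≡⟨ cong +_ (m*n/n≡m (a C i) (suc a)) ⟩
    + (a C i)                              ∎
    where
    a = m ∸ i
    quotient : ℕ → ℤ
    quotient t = (+ (t ∸ i) ℤ.* + (t C i)) /ℕ suc (t ∸ 1)
    numerator : + suc m ℤ.- + (2 * i) ≡ + (suc m ∸ i ∸ i)
    numerator = begin
      + suc m ℤ.- + (2 * i) ≡⟨ [+m]-[+n]≡m⊖n (suc m) (2 * i) ⟩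
      suc m ⊖ (2 * i)       ≡⟨ ⊖-≥ (subst (_≤ suc m) (cong (λ t → i + t) (sym (+-identityʳ i))) 2i≤1+m) ⟩
      + (suc m ∸ 2 * i)     ≡⟨ cong (λ t → + (suc m ∸ (i + t))) (+-identityʳ i) ⟩
      + (suc m ∸ (i + i))   ≡⟨ cong +_ (∸-+-assoc (suc m) i i) ⟨
      + (suc m ∸ i ∸ i)     ∎

-- Integer coefficients act through the type-checking-optimised multiple _×′_, for which
-- con (+ 0) and con (+ 1) are definitionally 0# and 1#.
module IntegerCoefficients {c ℓ} (R : CommutativeRing c ℓ) where
  open import Data.Nat using (zero; suc)
  import Data.Nat.Properties as ℕ
  open import Data.Integer as ℤ using (ℤ; +_; -[1+_]; _⊖_)
  import Data.Integer.Properties as ℤ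
  open import Data.Maybe using (Maybe; just; nothing)
  import Relation.Binary.PropositionalEquality as ≡
  open import Relation.Nullary using (yes; no)
  open import Data.Sum using (inj₁; inj₂)
  open import Algebra.Solver.Ring.AlmostCommutativeRing
    using (fromCommutativeRing; _-Raw-AlmostCommutative⟶_)
  open CommutativeRing R
  open import Algebra.Properties.Semiring.Mult.TCOptimised semiring renaming (_×_ to _×′_) using (×-homo-+; ×1-homo-*)
  open import Algebra.Properties.Ring ring
    using (-0#≈0#; -‿involutive; -‿distribˡ-*; -‿distribʳ-*; -‿+-comm; ⁻¹-anti-homo‿-; quasigroup)
  open import Algebra.Properties.Quasigroup quasigroup using (x≈z//y)
  open import Relation.Binary.Reasoning.Setoid setoid

  ι : ℤ → Carrier
  ι (+ n)    = n ×′ 1#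
  ι -[1+ n ] = - (suc n ×′ 1#)

  ι-neg : ∀ i → ι (ℤ.- i) ≈ - ι i
  ι-neg (+ zero)  = sym -0#≈0#
  ι-neg (+ suc n) = refl
  ι-neg -[1+ n ]  = sym (-‿involutive _)

  [m∸n]×′1+n×′1≈m×′1 : ∀ {m n} → n ℕ.≤ m → (m ℕ.∸ n) ×′ 1# + n ×′ 1# ≈ m ×′ 1#
  [m∸n]×′1+n×′1≈m×′1 {m} {n} n≤m =
    trans (sym (×-homo-+ 1# (m ℕ.∸ n) n)) (reflexive (≡.cong (_×′ 1#) (ℕ.m∸n+n≡m n≤m)))

  ι-⊖ : ∀ m n → ι (m ⊖ n) ≈ m ×′ 1# - n ×′ 1#
  ι-⊖ m n with ℕ.≤-total n m
  ... | inj₁ n≤m = begin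
    ι (m ⊖ n)            ≡⟨ ≡.cong ι (ℤ.⊖-≥ n≤m) ⟩
    (m ℕ.∸ n) ×′ 1#      ≈⟨ x≈z//y _ _ _ ([m∸n]×′1+n×′1≈m×′1 n≤m) ⟩
    m ×′ 1# - n ×′ 1#    ∎
  ... | inj₂ m≤n = begin
    ι (m ⊖ n)            ≡⟨ ≡.cong ι (ℤ.⊖-≤ m≤n) ⟩
    ι (ℤ.- + (n ℕ.∸ m))  ≈⟨ ι-neg (+ (n ℕ.∸ m)) ⟩
    - ((n ℕ.∸ m) ×′ 1#)  ≈⟨ -‿cong (x≈z//y _ _ _ ([m∸n]×′1+n×′1≈m×′1 m≤n)) ⟩
    - (n ×′ 1# - m ×′ 1#) ≈⟨ ⁻¹-anti-homo‿- _ _ ⟩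
    m ×′ 1# - n ×′ 1#    ∎

  ι-+ : ∀ i j → ι (i ℤ.+ j) ≈ ι i + ι j
  ι-+ (+ m)    (+ n)    = ×-homo-+ 1# m n
  ι-+ (+ m)    -[1+ n ] = ι-⊖ m (suc n)
  ι-+ -[1+ m ] (+ n)    = trans (ι-⊖ n (suc m)) (+-comm _ _)
  ι-+ -[1+ m ] -[1+ n ] = begin
    ι (-[1+ m ] ℤ.+ -[1+ n ])          ≡⟨ ≡.cong ι (ℤ.neg-distrib-+ (+ suc m) (+ suc n)) ⟨
    ι (ℤ.- (+ suc m ℤ.+ + suc n))      ≈⟨ ι-neg (+ suc m ℤ.+ + suc n) ⟩
    - ι (+ suc m ℤ.+ + suc n)          ≈⟨ -‿cong (ι-+ (+ suc m) (+ suc n)) ⟩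
    - (suc m ×′ 1# + suc n ×′ 1#)      ≈⟨ -‿+-comm _ _ ⟨
    - (suc m ×′ 1#) + - (suc n ×′ 1#)  ∎

  ι-*-pos : ∀ m j → ι (+ m ℤ.* j) ≈ m ×′ 1# * ι j
  ι-*-pos m (+ n)    = trans (reflexive (≡.cong ι (≡.sym (ℤ.pos-* m n)))) (×1-homo-* m n)
  ι-*-pos m -[1+ n ] = begin
    ι (+ m ℤ.* -[1+ n ])          ≡⟨ ≡.cong ι (ℤ.neg-distribʳ-* (+ m) (+ suc n)) ⟨
    ι (ℤ.- (+ m ℤ.* + suc n))     ≈⟨ ι-neg (+ m ℤ.* + suc n) ⟩
    - ι (+ m ℤ.* + suc n)         ≈⟨ -‿cong (ι-*-pos m (+ suc n)) ⟩
    - (m ×′ 1# * suc n ×′ 1#)     ≈⟨ -‿distribʳ-* _ _ ⟩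
    m ×′ 1# * - (suc n ×′ 1#)     ∎

  ι-* : ∀ i j → ι (i ℤ.* j) ≈ ι i * ι j
  ι-* (+ m)    j = ι-*-pos m j
  ι-* -[1+ m ] j = begin
    ι (-[1+ m ] ℤ.* j)            ≡⟨ ≡.cong ι (ℤ.neg-distribˡ-* (+ suc m) j) ⟨
    ι (ℤ.- (+ suc m ℤ.* j))       ≈⟨ ι-neg (+ suc m ℤ.* j) ⟩
    - ι (+ suc m ℤ.* j)           ≈⟨ -‿cong (ι-*-pos (suc m) j) ⟩
    - (suc m ×′ 1# * ι j)         ≈⟨ -‿distribˡ-* _ _ ⟩
    - (suc m ×′ 1#) * ι j         ∎

  ι-homomorphism : ℤ.+-*-rawRing -Raw-AlmostCommutative⟶ fromCommutativeRing R
  ι-homomorphism = record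
    { ⟦_⟧    = ι
    ; +-homo = ι-+
    ; *-homo = ι-*
    ; -‿homo = ι-neg
    ; 0-homo = refl
    ; 1-homo = refl
    }

  ι-equal? : ∀ i j → Maybe (ι i ≈ ι j)
  ι-equal? i j with i ℤ.≟ j
  ... | yes ≡.refl = just refl
  ... | no  _      = nothing

  open import Algebra.Solver.Ring ℤ.+-*-rawRing (fromCommutativeRing R) ι-homomorphism ι-equal? public
    using (solve; _:+_; _:*_; _:-_; :-_; con; _:=_)

module LucasSequences {c ℓ} (R : CommutativeRing c ℓ) where
  open import Data.Nat using (ℕ; zero; suc)
  open import Data.Integer using (+_)
  import Data.Product as Product
  open Product using (_,_; proj₁)
  open CommutativeRing R
  open import Algebra.Properties.Semiring.Mult semiring using (_×_)
  open import Algebra.Properties.Semiring.Exp semiring using (_^_)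
  open IntegerCoefficients R using (solve; _:+_; _:*_; _:-_; con; _:=_)
  open import Relation.Binary.Reasoning.Setoid setoid

  -- s k = U_{k+1}(σ, π), where U₀ = 0, U₁ = 1 and U_{n+2} = σ U_{n+1} - π U_n.
  record IsLucasU (σ π : Carrier) (s : ℕ → Carrier) : Set ℓ where
    field
      start₀ : s 0 ≈ 1#
      start₁ : s 1 ≈ σ
      step   : ∀ k → s (suc (suc k)) ≈ σ * s (suc k) - π * s k

  module _ {σ π s} (lucas : IsLucasU σ π s) where
    open IsLucasU lucas

    lucasU-binet : ∀ {y z} → σ ≈ y + z → π ≈ y * z → ∀ k → (y - z) * s k ≈ y ^ suc k - z ^ suc k
    lucasU-binet {y} {z} σ≈y+z π≈yz k = proj₁ (consecutive k)
      where
      Binet : ℕ → Set ℓ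
      Binet k = (y - z) * s k ≈ y ^ suc k - z ^ suc k

      consecutive : ∀ k → Binet k Product.× Binet (suc k)
      consecutive zero =
          trans (*-congˡ start₀) (solve 2 (λ y z → (y :- z) :* con (+ 1) := y :* con (+ 1) :- z :* con (+ 1)) refl y z)
        , trans (*-congˡ (trans start₁ σ≈y+z))
                (solve 2 (λ y z → (y :- z) :* (y :+ z) := y :* (y :* con (+ 1)) :- z :* (z :* con (+ 1))) refl y z)
      consecutive (suc k) with consecutive k
      ... | ih₀ , ih₁ = ih₁ , (begin
        (y - z) * s (suc (suc k))
          ≈⟨ *-congˡ (trans (step k) (+-cong (*-congʳ σ≈y+z) (-‿cong (*-congʳ π≈yz)))) ⟩
        (y - z) * ((y + z) * s (suc k) - y * z * s k)
          ≈⟨ solve 4 (λ y z S₁ S₀ → (y :- z) :* ((y :+ z) :* S₁ :- y :* z :* S₀)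
                                  := (y :+ z) :* ((y :- z) :* S₁) :- y :* z :* ((y :- z) :* S₀)) refl y z (s (suc k)) (s k) ⟩
        (y + z) * ((y - z) * s (suc k)) - y * z * ((y - z) * s k)
          ≈⟨ +-cong (*-congˡ ih₁) (-‿cong (*-congˡ ih₀)) ⟩
        (y + z) * (y * Y - z * Z) - y * z * (Y - Z)
          ≈⟨ solve 4 (λ y z Y Z → (y :+ z) :* (y :* Y :- z :* Z) :- y :* z :* (Y :- Z)
                               := y :* (y :* Y) :- z :* (z :* Z)) refl y z Y Z ⟩
        y * (y * Y) - z * (z * Z)
          ∎)
        where
        Y = y ^ suc k
        Z = z ^ suc k

    lucasU-double-root : ∀ {y} → σ ≈ y + y → π ≈ y * y → ∀ k → s k ≈ (suc k × 1#) * y ^ k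
    lucasU-double-root {y} σ≈2y π≈y² k = proj₁ (consecutive k)
      where
      DoubleRoot : ℕ → Set ℓ
      DoubleRoot k = s k ≈ (suc k × 1#) * y ^ k

      consecutive : ∀ k → DoubleRoot k Product.× DoubleRoot (suc k)
      consecutive zero =
          trans start₀ (solve 0 (con (+ 1) := (con (+ 1) :+ con (+ 0)) :* con (+ 1)) refl)
        , trans start₁ (trans σ≈2y
            (solve 1 (λ y → y :+ y := (con (+ 1) :+ (con (+ 1) :+ con (+ 0))) :* (y :* con (+ 1))) refl y))
      consecutive (suc k) with consecutive k
      ... | ih₀ , ih₁ = ih₁ , (begin
        s (suc (suc k))
          ≈⟨ trans (step k) (+-cong (*-congʳ σ≈2y) (-‿cong (*-congʳ π≈y²))) ⟩
        (y + y) * s (suc k) - y * y * s k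
          ≈⟨ +-cong (*-congˡ ih₁) (-‿cong (*-congˡ ih₀)) ⟩
        (y + y) * ((1# + (1# + K)) * (y * Y)) - y * y * ((1# + K) * Y)
          ≈⟨ solve 3 (λ y K Y → (y :+ y) :* ((con (+ 1) :+ (con (+ 1) :+ K)) :* (y :* Y)) :- y :* y :* ((con (+ 1) :+ K) :* Y)
                             := (con (+ 1) :+ (con (+ 1) :+ (con (+ 1) :+ K))) :* (y :* (y :* Y))) refl y K Y ⟩
        (1# + (1# + (1# + K))) * (y * (y * Y))
          ∎)
        where
        K = k × 1#
        Y = y ^ k

module Powers {c ℓ} (R : CommutativeRing c ℓ) where
  open import Data.Nat using (zero; suc)
  open import Data.Integer using (+_)
  open import Data.Product using (_×_; _,_)
  open import Data.Sum using (_⊎_; inj₁; inj₂)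
  open CommutativeRing R
  open import Algebra.Properties.Semiring.Exp semiring using (_^_; ^-congˡ; ^-assocʳ; ^-homo-*)
  open import Algebra.Properties.CommutativeSemiring.Exp commutativeSemiring using (^-distrib-*)
  open IntegerCoefficients R using (solve; _:*_; :-_; con; _:=_)

  [-1]^n≈±1 : ∀ n → (- 1#) ^ n ≈ 1# ⊎ (- 1#) ^ n ≈ - 1#
  [-1]^n≈±1 zero = inj₁ refl
  [-1]^n≈±1 (suc n) with [-1]^n≈±1 n
  ... | inj₁ ≈1  = inj₂ (trans (*-congˡ ≈1) (*-identityʳ _))
  ... | inj₂ ≈-1 = inj₁ (trans (*-congˡ ≈-1) (solve 0 (:- con (+ 1) :* :- con (+ 1) := con (+ 1)) refl))

  u²≈-1⇒u^[r+r]≈[-1]^r : ∀ {u} → u * u ≈ - 1# → ∀ r → u ^ (r ℕ.+ r) ≈ (- 1#) ^ r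
  u²≈-1⇒u^[r+r]≈[-1]^r {u} u²≈-1 r = trans (^-homo-* u r r) (trans (sym (^-distrib-* u u r)) (^-congˡ r u²≈-1))

  u²≈-1⇒u^odd≈±u : ∀ {u} → u * u ≈ - 1# → ∀ r → u ^ suc (r ℕ.+ r) ≈ u ⊎ u ^ suc (r ℕ.+ r) ≈ - u
  u²≈-1⇒u^odd≈±u {u} u²≈-1 r with [-1]^n≈±1 r
  ... | inj₁ ≈1  = inj₁ (trans (*-congˡ (trans (u²≈-1⇒u^[r+r]≈[-1]^r u²≈-1 r) ≈1)) (*-identityʳ u))
  ... | inj₂ ≈-1 = inj₂ (trans (*-congˡ (trans (u²≈-1⇒u^[r+r]≈[-1]^r u²≈-1 r) ≈-1))
                               (solve 1 (λ u → u :* :- con (+ 1) := :- u) refl u))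

  PermutedByPower : ℕ.ℕ → Carrier → Carrier → Set ℓ
  PermutedByPower M y z = (y ^ M ≈ y × z ^ M ≈ z) ⊎ (y ^ M ≈ z × z ^ M ≈ y)

  ^-*-compose : ∀ M K {u v w} → u ^ M ≈ v → v ^ K ≈ w → u ^ (M ℕ.* K) ≈ w
  ^-*-compose M K {u} uᴹ≈v vᴷ≈w = trans (sym (^-assocʳ u M K)) (trans (^-congˡ K uᴹ≈v) vᴷ≈w)

  module _ {y z : Carrier} where

    permutedByPower-* : ∀ {M K} → PermutedByPower M y z → PermutedByPower K y z → PermutedByPower (M ℕ.* K) y z
    permutedByPower-* {M} {K} (inj₁ (yᴹ , zᴹ)) (inj₁ (yᴷ , zᴷ)) = inj₁ (^-*-compose M K yᴹ yᴷ , ^-*-compose M K zᴹ zᴷ)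
    permutedByPower-* {M} {K} (inj₁ (yᴹ , zᴹ)) (inj₂ (yᴷ , zᴷ)) = inj₂ (^-*-compose M K yᴹ yᴷ , ^-*-compose M K zᴹ zᴷ)
    permutedByPower-* {M} {K} (inj₂ (yᴹ , zᴹ)) (inj₁ (yᴷ , zᴷ)) = inj₂ (^-*-compose M K yᴹ zᴷ , ^-*-compose M K zᴹ yᴷ)
    permutedByPower-* {M} {K} (inj₂ (yᴹ , zᴹ)) (inj₂ (yᴷ , zᴷ)) = inj₁ (^-*-compose M K yᴹ zᴷ , ^-*-compose M K zᴹ yᴷ)

    permutedByPower-^ : ∀ {M} → PermutedByPower M y z → ∀ l → PermutedByPower (M ℕ.^ l) y z
    permutedByPower-^ perm zero        = inj₁ (*-identityʳ y , *-identityʳ z)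
    permutedByPower-^ {M} perm (suc l) = permutedByPower-* {M} {M ℕ.^ l} perm (permutedByPower-^ perm l)

module Frobenius {c ℓ} (R : CommutativeRing c ℓ) where
  open import Data.Nat using (zero; suc; s≤s; z≤n)
  import Data.Nat.Properties as ℕ
  open import Data.Nat.Combinatorics using (_C_; nCn≡1)
  open import Data.Nat.Divisibility using (divides)
  open import Data.Sum using (_⊎_; inj₁; inj₂)
  open import Data.Product using (_,_)
  open import Data.Fin using (Fin; zero; suc; fromℕ; inject₁)
  import Data.Fin.Properties as Fin
  open import Data.Vec.Functional using (replicate)
  import Relation.Binary.PropositionalEquality as ≡
  open CommutativeRing R hiding (zero)
  open import Algebra.Properties.Semiring.Mult semiring using (_×_; ×-assoc-*; ×-assocˡ; ×-congʳ; ×-congˡ; ×-homo-1)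
  open import Algebra.Properties.Semiring.Exp semiring using (_^_; ^-congˡ)
  open import Algebra.Properties.CommutativeSemiring.Exp commutativeSemiring using (^-distrib-*)
  open import Algebra.Properties.Monoid.Sum +-monoid using (sum; sum-init-last; sum-cong-≋; sum-replicate-zero)
  open import Algebra.Properties.CommutativeSemiring.Binomial commutativeSemiring using (theorem; binomialTerm)
  open import Algebra.Properties.Ring ring using (+-inverseˡ-unique; -‿involutive)
  open import Relation.Binary.Reasoning.Setoid setoid
  open IntegerCoefficients R using (solve; _:*_; _:=_)
  open Binomial using (prime∣pCk)
  open Powers R using (PermutedByPower)

  multiple-of-char≈0 : ∀ {p} → p × 1# ≈ 0# → ∀ d z → (d ℕ.* p) × z ≈ 0#
  multiple-of-char≈0 {p} char-p d z = begin
    (d ℕ.* p) × z    ≡⟨ ≡.cong (_× z) (ℕ.*-comm d p) ⟩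
    (p ℕ.* d) × z    ≈⟨ ×-assocˡ z p d ⟨
    p × (d × z)      ≈⟨ ×-congʳ p (*-identityˡ _) ⟨
    p × (1# * d × z) ≈⟨ ×-assoc-* p 1# _ ⟨
    p × 1# * d × z   ≈⟨ *-congʳ char-p ⟩
    0# * d × z       ≈⟨ zeroˡ _ ⟩
    0#               ∎

  frobenius : ∀ {p} → Prime p → p × 1# ≈ 0# → ∀ x y → (x + y) ^ p ≈ x ^ p + y ^ p
  frobenius {suc (suc m)} p-prime char-p x y = begin
    (x + y) ^ p                                               ≈⟨ theorem p x y ⟩
    T zero + sum (λ i → T (suc i))                            ≈⟨ +-congˡ (sum-init-last (λ i → T (suc i))) ⟩
    T zero + (sum (λ i → T (suc (inject₁ i))) + T (fromℕ p))  ≈⟨ +-congˡ (+-congʳ (sum-cong-≋ middle≈0)) ⟩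
    T zero + (sum (replicate (suc m) 0#) + T (fromℕ p))       ≈⟨ +-congˡ (+-congʳ (sum-replicate-zero (suc m))) ⟩
    T zero + (0# + T (fromℕ p))                               ≈⟨ +-comm _ _ ⟩
    (0# + T (fromℕ p)) + T zero                               ≈⟨ +-cong (+-identityˡ _) first≈yᵖ ⟩
    T (fromℕ p) + y ^ p                                       ≈⟨ +-congʳ last≈xᵖ ⟩
    x ^ p + y ^ p                                             ∎
    where
    p = suc (suc m)
    T = binomialTerm x y p
    middle≈0 : ∀ (i : Fin (suc m)) → T (suc (inject₁ i)) ≈ 0#
    middle≈0 i with prime∣pCk p-prime (s≤s z≤n) (s≤s (≡.subst (ℕ._< suc m) (≡.sym (Fin.toℕ-inject₁ i)) (Fin.toℕ<n i)))
    ... | divides d pCk≡dp = trans (×-congˡ pCk≡dp) (multiple-of-char≈0 char-p d _)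
    first≈yᵖ : T zero ≈ y ^ p
    first≈yᵖ = trans (×-homo-1 _) (*-identityˡ _)
    last≈xᵖ : T (fromℕ p) ≈ x ^ p
    last≈xᵖ = begin
      T (fromℕ p)                        ≡⟨ ≡.cong (λ k → (p C k) × (x ^ k * y ^ (p ℕ.∸ k))) (Fin.toℕ-fromℕ p) ⟩
      (p C p) × (x ^ p * y ^ (p ℕ.∸ p))  ≡⟨ ≡.cong₂ (λ a b → a × (x ^ p * y ^ b)) (nCn≡1 p) (ℕ.n∸n≡0 p) ⟩
      1 × (x ^ p * 1#)                   ≈⟨ trans (×-homo-1 _) (*-identityʳ _) ⟩
      x ^ p                              ∎

  frobenius-neg : ∀ {p} → Prime p → p × 1# ≈ 0# → ∀ x → (- x) ^ p ≈ - (x ^ p)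
  frobenius-neg {suc m} p-prime char-p x = +-inverseˡ-unique _ _ (begin
    (- x) ^ suc m + x ^ suc m ≈⟨ frobenius p-prime char-p (- x) x ⟨
    (- x + x) ^ suc m         ≈⟨ *-congʳ (-‿inverseˡ x) ⟩
    0# * (- x + x) ^ m        ≈⟨ zeroˡ _ ⟩
    0#                        ∎)

  frobenius-sub : ∀ {p} → Prime p → p × 1# ≈ 0# → ∀ x y → (x - y) ^ p ≈ x ^ p - y ^ p
  frobenius-sub p-prime char-p x y = trans (frobenius p-prime char-p x (- y)) (+-congˡ (frobenius-neg p-prime char-p y))

  frobenius-conjugates : ∀ {p} → Prime p → p × 1# ≈ 0# → ∀ {a b} → a ^ p ≈ a → b ^ p ≈ b ⊎ b ^ p ≈ - b →
                         PermutedByPower p (a + b) (a - b)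
  frobenius-conjugates p-prime char-p {a} {b} aᵖ≈a (inj₁ bᵖ≈b) =
    inj₁ ( trans (frobenius p-prime char-p a b) (+-cong aᵖ≈a bᵖ≈b)
         , trans (frobenius-sub p-prime char-p a b) (+-cong aᵖ≈a (-‿cong bᵖ≈b)))
  frobenius-conjugates p-prime char-p {a} {b} aᵖ≈a (inj₂ bᵖ≈-b) =
    inj₂ ( trans (frobenius p-prime char-p a b) (+-cong aᵖ≈a bᵖ≈-b)
         , trans (frobenius-sub p-prime char-p a b) (+-cong aᵖ≈a (trans (-‿cong bᵖ≈-b) (-‿involutive b))))

  1#^n≈1# : ∀ n → 1# ^ n ≈ 1#
  1#^n≈1# zero    = refl
  1#^n≈1# (suc n) = trans (*-identityˡ _) (1#^n≈1# n)

  frobenius-fixes-×1 : ∀ {p} → Prime p → p × 1# ≈ 0# → ∀ n → (n × 1#) ^ p ≈ n × 1#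
  frobenius-fixes-×1 {suc m} p-prime char-p zero    = zeroˡ _
  frobenius-fixes-×1 {p}     p-prime char-p (suc n) =
    trans (frobenius p-prime char-p 1# (n × 1#)) (+-cong (1#^n≈1# p) (frobenius-fixes-×1 p-prime char-p n))

  ^-fixed-inverse : ∀ {a b} n → a ^ n ≈ a → a * b ≈ 1# → b ^ n ≈ b
  ^-fixed-inverse {a} {b} n aⁿ≈a ab≈1 = begin
    b ^ n              ≈⟨ *-identityˡ _ ⟨
    1# * b ^ n         ≈⟨ *-congʳ ab≈1 ⟨
    a * b * b ^ n      ≈⟨ solve 3 (λ a b B → a :* b :* B := a :* B :* b) refl a b (b ^ n) ⟩
    a * b ^ n * b      ≈⟨ *-congʳ (*-congʳ aⁿ≈a) ⟨
    a ^ n * b ^ n * b  ≈⟨ *-congʳ (^-distrib-* a b n) ⟨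
    (a * b) ^ n * b    ≈⟨ *-congʳ (trans (^-congˡ n ab≈1) (1#^n≈1# n)) ⟩
    1# * b             ≈⟨ *-identityˡ b ⟩
    b                  ∎

-- R[i] = R[X]/(X² + 1): the pair (a , b) stands for a + b i, and the additive group is R × R.
module GaussianExtension {c ℓ} (R : CommutativeRing c ℓ) where
  open import Data.Nat using (zero; suc)
  open import Data.Integer using (+_)
  open import Data.Product using (_×_; _,_)
  open import Algebra.Bundles using (AbelianGroup)
  open import Algebra.Structures using (IsCommutativeRing)
  import Algebra.Construct.DirectProduct as DirectProduct
  open CommutativeRing R
  open import Algebra.Properties.Semiring.Exp semiring using (_^_)
  open import Algebra.Properties.Ring ring using (-0#≈0#)
  open IntegerCoefficients R using (solve; _:+_; _:*_; _:-_; :-_; con; _:=_)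
  open LucasSequences using (IsLucasU)

  private
    module ⊕ = AbelianGroup (DirectProduct.abelianGroup +-abelianGroup +-abelianGroup)

  _⊗_ : Carrier × Carrier → Carrier × Carrier → Carrier × Carrier
  (a , b) ⊗ (c , d) = (a * c - b * d , a * d + b * c)

  R[i]-isCommutativeRing : IsCommutativeRing ⊕._≈_ ⊕._∙_ _⊗_ ⊕._⁻¹ ⊕.ε (1# , 0#)
  R[i]-isCommutativeRing = record
    { isRing = record
      { +-isAbelianGroup = ⊕.isAbelianGroup
      ; *-cong = λ (a , b) (c , d) → +-cong (*-cong a c) (-‿cong (*-cong b d)) , +-cong (*-cong a d) (*-cong b c)
      ; *-assoc = λ (a , b) (c , d) (e , f) →
          solve 6 (λ a b c d e f → (a :* c :- b :* d) :* e :- (a :* d :+ b :* c) :* f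
                                := a :* (c :* e :- d :* f) :- b :* (c :* f :+ d :* e)) refl a b c d e f
        , solve 6 (λ a b c d e f → (a :* c :- b :* d) :* f :+ (a :* d :+ b :* c) :* e
                                := a :* (c :* f :+ d :* e) :+ b :* (c :* e :- d :* f)) refl a b c d e f
      ; *-identity =
          (λ (a , b) → solve 2 (λ a b → con (+ 1) :* a :- con (+ 0) :* b := a) refl a b
                     , solve 2 (λ a b → con (+ 1) :* b :+ con (+ 0) :* a := b) refl a b)
        , (λ (a , b) → solve 2 (λ a b → a :* con (+ 1) :- b :* con (+ 0) := a) refl a b
                     , solve 2 (λ a b → a :* con (+ 0) :+ b :* con (+ 1) := b) refl a b)
      ; distrib =
          (λ (a , b) (c , d) (e , f) →
              solve 6 (λ a b c d e f → a :* (c :+ e) :- b :* (d :+ f) := (a :* c :- b :* d) :+ (a :* e :- b :* f)) refl a b c d e f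
            , solve 6 (λ a b c d e f → a :* (d :+ f) :+ b :* (c :+ e) := (a :* d :+ b :* c) :+ (a :* f :+ b :* e)) refl a b c d e f)
        , (λ (a , b) (c , d) (e , f) →
              solve 6 (λ a b c d e f → (c :+ e) :* a :- (d :+ f) :* b := (c :* a :- d :* b) :+ (e :* a :- f :* b)) refl a b c d e f
            , solve 6 (λ a b c d e f → (c :+ e) :* b :+ (d :+ f) :* a := (c :* b :+ d :* a) :+ (e :* b :+ f :* a)) refl a b c d e f)
      }
    ; *-comm = λ (a , b) (c , d) →
          solve 4 (λ a b c d → a :* c :- b :* d := c :* a :- d :* b) refl a b c d
        , solve 4 (λ a b c d → a :* d :+ b :* c := c :* b :+ d :* a) refl a b c d
    }

  R[i] : CommutativeRing c ℓ
  R[i] = record { isCommutativeRing = R[i]-isCommutativeRing }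

  private
    module Rᵢ = CommutativeRing R[i]
  open import Algebra.Properties.Semiring.Exp Rᵢ.semiring using () renaming (_^_ to _^ᵢ_)

  i : Rᵢ.Carrier
  i = (0# , 1#)

  embed : Carrier → Rᵢ.Carrier
  embed a = (a , 0#)

  i²≈-1 : i Rᵢ.* i Rᵢ.≈ Rᵢ.- Rᵢ.1#
  i²≈-1 = solve 0 (con (+ 0) :* con (+ 0) :- con (+ 1) :* con (+ 1) := :- con (+ 1)) refl
        , solve 0 (con (+ 0) :* con (+ 1) :+ con (+ 1) :* con (+ 0) := :- con (+ 0)) refl

  embed-+ : ∀ a b → embed (a + b) Rᵢ.≈ embed a Rᵢ.+ embed b
  embed-+ a b = refl , sym (+-identityʳ 0#)

  embed-* : ∀ a b → embed (a * b) Rᵢ.≈ embed a Rᵢ.* embed b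
  embed-* a b = sym (trans (+-congˡ (trans (-‿cong (zeroˡ 0#)) -0#≈0#)) (+-identityʳ _))
              , sym (trans (+-cong (zeroʳ a) (zeroˡ b)) (+-identityʳ 0#))

  embed-neg : ∀ a → embed (- a) Rᵢ.≈ Rᵢ.- embed a
  embed-neg a = refl , sym -0#≈0#

  embed-^ : ∀ a n → embed (a ^ n) Rᵢ.≈ embed a ^ᵢ n
  embed-^ a zero    = Rᵢ.refl
  embed-^ a (suc n) = Rᵢ.trans (embed-* a (a ^ n)) (Rᵢ.*-congˡ (embed-^ a n))

  embed-×1 : ∀ n → embed (Mult._×_ semiring n 1#) Rᵢ.≈ Mult._×_ Rᵢ.semiring n Rᵢ.1#
  embed-×1 zero    = Rᵢ.refl
  embed-×1 (suc n) = Rᵢ.trans (embed-+ 1# _) (Rᵢ.+-congˡ (embed-×1 n))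

  embed-isLucasU : ∀ {σ π s} → IsLucasU R σ π s → IsLucasU R[i] (embed σ) (embed π) (λ k → embed (s k))
  embed-isLucasU {σ} {π} {s} lucas = record
    { start₀ = start₀ , refl
    ; start₁ = start₁ , refl
    ; step   = λ k → Rᵢ.trans (step k , refl) (Rᵢ.trans (embed-+ _ _)
                 (Rᵢ.+-cong (embed-* σ (s (suc k))) (Rᵢ.trans (embed-neg _) (Rᵢ.-‿cong (embed-* π (s k))))))
    }
    where open IsLucasU lucas

module FiniteFieldProperties {c ℓ q} (F : FiniteField c ℓ q) where
  open import Data.Nat using (zero; suc)
  open import Data.Fin as Fin using (Fin)
  open import Data.Fin.Permutation using (permutation)
  open import Data.Product using (proj₁; proj₂)
  open import Data.Empty using (⊥-elim)
  open import Function.Bundles using (Bijection)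
  open import Relation.Binary.Definitions using (Decidable)
  import Relation.Binary.PropositionalEquality as ≡
  open import Relation.Nullary using (yes; no)
  open FiniteField F
  open import Algebra.Properties.Semiring.Mult semiring using (_×_; ×1-homo-*)
  open import Algebra.Properties.Semiring.Exp semiring using (_^_)
  open import Algebra.Properties.Monoid.Sum +-monoid using (sum; sum-cong-≋; sum-replicate)
  open import Algebra.Properties.CommutativeMonoid.Sum +-commutativeMonoid using (sum-permute; ∑-distrib-+)
  open import Algebra.Properties.Ring ring using (+-identityʳ-unique)
  open import Algebra.Properties.Group +-group using (//-rightDividesˡ; //-rightDividesʳ)
  open import Relation.Binary.Reasoning.Setoid setoid
  open Bijection enum using (to; injective; surjective)

  private
    from : Carrier → Fin q
    from y = proj₁ (surjective y)

    to-from : ∀ y → to (from y) ≈ y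
    to-from y = proj₂ (surjective y) ≡.refl

  infix 4 _≟_
  _≟_ : Decidable _≈_
  a ≟ b with from a Fin.≟ from b
  ... | yes eq = yes (trans (sym (to-from a)) (trans (reflexive (≡.cong to eq)) (to-from b)))
  ... | no  ne = no (λ a≈b → ne (injective (trans (to-from a) (trans a≈b (sym (to-from b))))))

  q×x≈0 : ∀ x → q × x ≈ 0#
  q×x≈0 x = +-identityʳ-unique (sum to) (q × x) (begin
    sum to + q × x              ≈⟨ +-congˡ (sum-replicate q) ⟨
    sum to + sum {q} (λ _ → x)  ≈⟨ ∑-distrib-+ to (λ _ → x) ⟨
    sum (λ j → to j + x)        ≈⟨ sum-cong-≋ (λ j → to-from (to j + x)) ⟨
    sum (λ j → to (shift j))    ≈⟨ sum-permute to (permutation shift unshift shift∘unshift unshift∘shift) ⟨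
    sum to                      ∎)
    where
    shift unshift : Fin q → Fin q
    shift   j = from (to j + x)
    unshift j = from (to j - x)
    shift∘unshift : ∀ j → shift (unshift j) ≡ j
    shift∘unshift j = injective (trans (to-from _) (trans (+-congʳ (to-from _)) (//-rightDividesˡ x (to j))))
    unshift∘shift : ∀ j → unshift (shift j) ≡ j
    unshift∘shift j = injective (trans (to-from _) (trans (+-congʳ (to-from _)) (//-rightDividesʳ x (to j))))

  x^[1+n]≈0⇒x≈0 : ∀ x n → x ^ suc n ≈ 0# → x ≈ 0#
  x^[1+n]≈0⇒x≈0 x n xⁿ⁺¹≈0 with x ≟ 0#
  ... | yes x≈0 = x≈0
  ... | no  x≉0 = ⊥-elim (1≉0 (descend (suc n) xⁿ⁺¹≈0))
    where
    x⁻¹ = proj₁ (inverse x x≉0)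
    descend : ∀ n → x ^ n ≈ 0# → 1# ≈ 0#
    descend zero    1≈0     = 1≈0
    descend (suc n) xⁿ⁺¹≈0 = descend n (begin
      x ^ n              ≈⟨ *-identityʳ _ ⟨
      x ^ n * 1#         ≈⟨ *-congˡ (proj₂ (inverse x x≉0)) ⟨
      x ^ n * (x * x⁻¹)  ≈⟨ *-assoc _ _ _ ⟨
      x ^ n * x * x⁻¹    ≈⟨ *-congʳ (*-comm _ _) ⟩
      x ^ suc n * x⁻¹    ≈⟨ *-congʳ xⁿ⁺¹≈0 ⟩
      0# * x⁻¹           ≈⟨ zeroˡ _ ⟩
      0#                 ∎)

  [m^n]×1≈[m×1]^n : ∀ m n → (m ℕ.^ n) × 1# ≈ (m × 1#) ^ n
  [m^n]×1≈[m×1]^n m zero    = +-identityʳ 1#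
  [m^n]×1≈[m×1]^n m (suc n) = trans (×1-homo-* m (m ℕ.^ n)) (*-congˡ ([m^n]×1≈[m×1]^n m n))

  characteristic : ∀ {p e} → p ℕ.^ suc e ≡ q → p × 1# ≈ 0#
  characteristic {p} {e} pᵉ⁺¹≡q = x^[1+n]≈0⇒x≈0 (p × 1#) e (begin
    (p × 1#) ^ suc e     ≈⟨ [m^n]×1≈[m×1]^n p (suc e) ⟨
    (p ℕ.^ suc e) × 1#   ≡⟨ ≡.cong (_× 1#) pᵉ⁺¹≡q ⟩
    q × 1#               ≈⟨ q×x≈0 1# ⟩
    0#                   ∎)

module DicksonSecondKind {c ℓ q} (F : FiniteField c ℓ q) where
  open import Data.Nat using (ℕ; zero; suc; _∸_; _≤_; _<_; _≤′_; ≤′-refl; ≤′-step; z≤n; s≤s; ⌊_/2⌋)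
  import Data.Nat.Properties as ℕ
  open import Data.Nat.Combinatorics using (_C_)
  open import Data.Integer using (+_)
  import Relation.Binary.PropositionalEquality as ≡
  open FiniteField F
  open IntegerCoefficients cring using (solve; _:+_; _:*_; _:-_; :-_; con; _:=_)
  open LucasSequences cring using (IsLucasU)
  open Parity using (i≤⌊n/2⌋⇒i+i≤n; ⌊n/2⌋<i⇒n<i+i)
  open Binomial using ([m∸i]Ci≡0; [1+m∸i]C[1+i]≡[m∸i]Ci+[m∸i]C[1+i])
  open DicksonCoefficient using (Dcoeff[1+m,2,i]≡[m∸i]Ci)
  open import Relation.Binary.Reasoning.Setoid setoid

  Σ[≤_] : ℕ → (ℕ → Carrier) → Carrier
  Σ[≤_] = sumTo F

  sumTo-cong : ∀ N {f g} → (∀ i → i ≤ N → f i ≈ g i) → Σ[≤ N ] f ≈ Σ[≤ N ] g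
  sumTo-cong zero    f≈g = f≈g 0 z≤n
  sumTo-cong (suc N) f≈g = +-cong (sumTo-cong N (λ i i≤N → f≈g i (ℕ.m≤n⇒m≤1+n i≤N))) (f≈g (suc N) ℕ.≤-refl)

  sumTo-+ : ∀ N f g → Σ[≤ N ] (λ i → f i + g i) ≈ Σ[≤ N ] f + Σ[≤ N ] g
  sumTo-+ zero    f g = refl
  sumTo-+ (suc N) f g = trans (+-congʳ (sumTo-+ N f g))
    (solve 4 (λ a b c d → (a :+ b) :+ (c :+ d) := (a :+ c) :+ (b :+ d)) refl _ _ _ _)

  sumTo-*ˡ : ∀ N a f → Σ[≤ N ] (λ i → a * f i) ≈ a * Σ[≤ N ] f
  sumTo-*ˡ zero    a f = refl
  sumTo-*ˡ (suc N) a f = trans (+-congʳ (sumTo-*ˡ N a f)) (sym (distribˡ _ _ _))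

  sumTo-suc : ∀ N f → Σ[≤ suc N ] f ≈ f 0 + Σ[≤ N ] (λ i → f (suc i))
  sumTo-suc zero    f = refl
  sumTo-suc (suc N) f = trans (+-congʳ (sumTo-suc N f)) (+-assoc _ _ _)

  sumTo-extend : ∀ {N M} f → N ≤′ M → (∀ i → N < i → f i ≈ 0#) → Σ[≤ M ] f ≈ Σ[≤ N ] f
  sumTo-extend f ≤′-refl          _   = refl
  sumTo-extend f (≤′-step N≤′M) f≈0 =
    trans (+-cong (sumTo-extend f N≤′M f≈0) (f≈0 _ (s≤s (ℕ.≤′⇒≤ N≤′M)))) (+-identityʳ _)

  sumTo-last≈0 : ∀ N f → f (suc N) ≈ 0# → Σ[≤ suc N ] f ≈ Σ[≤ N ] f
  sumTo-last≈0 N f fᴺ⁺¹≈0 = trans (+-congˡ fᴺ⁺¹≈0) (+-identityʳ _)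

  ℕ→F-+ : ∀ m n → ℕ→F F (m ℕ.+ n) ≈ ℕ→F F m + ℕ→F F n
  ℕ→F-+ zero    n = sym (+-identityˡ _)
  ℕ→F-+ (suc m) n = trans (+-congˡ (ℕ→F-+ m n)) (sym (+-assoc _ _ _))

  term : ℕ → Carrier → ℕ → Carrier
  term m x i = ℕ→F F ((m ∸ i) C i) * pow F (- x) i

  -- The Dickson polynomial of the second kind E_m(1, x); summing up to m rather than
  -- ⌊m/2⌋ only adds vanishing terms.
  E : ℕ → Carrier → Carrier
  E m x = Σ[≤ m ] (term m x)

  term≈0 : ∀ m x i → m < i ℕ.+ i → term m x i ≈ 0#
  term≈0 m x i m<2i = trans (*-congʳ (reflexive (≡.cong (ℕ→F F) ([m∸i]Ci≡0 m i m<2i)))) (zeroˡ _)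

  term-last≈0 : ∀ m x → term m x (suc m) ≈ 0#
  term-last≈0 m x = term≈0 m x (suc m) (ℕ.≤-trans (ℕ.n<1+n m) (ℕ.m≤m+n (suc m) (suc m)))

  term-pascal : ∀ m x j → term (suc (suc m)) x (suc j) ≈ - x * term m x j + term (suc m) x (suc j)
  term-pascal m x j = begin
    ℕ→F F ((suc m ∸ j) C suc j) * (- x * P)
      ≈⟨ *-congʳ (trans (reflexive (≡.cong (ℕ→F F) ([1+m∸i]C[1+i]≡[m∸i]Ci+[m∸i]C[1+i] m j)))
                        (ℕ→F-+ ((m ∸ j) C j) ((m ∸ j) C suc j))) ⟩
    (ℕ→F F ((m ∸ j) C j) + ℕ→F F ((m ∸ j) C suc j)) * (- x * P)
      ≈⟨ solve 4 (λ a b y P → (a :+ b) :* (y :* P) := y :* (a :* P) :+ b :* (y :* P)) refl _ _ (- x) P ⟩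
    - x * term m x j + term (suc m) x (suc j)
      ∎
    where P = pow F (- x) j

  E-isLucasU : ∀ x → IsLucasU 1# x (λ m → E m x)
  E-isLucasU x = record
    { start₀ = trans (*-identityʳ _) (+-identityʳ 1#)
    ; start₁ = trans (+-cong (*-identityʳ _) (zeroˡ _)) (trans (+-identityʳ _) (+-identityʳ 1#))
    ; step   = step
    }
    where
    step : ∀ m → E (suc (suc m)) x ≈ 1# * E (suc m) x - x * E m x
    step m = begin
      E (suc (suc m)) x
        ≈⟨ sumTo-suc (suc m) _ ⟩
      t₀ + Σ[≤ suc m ] (λ j → term (suc (suc m)) x (suc j))
        ≈⟨ +-congˡ (sumTo-cong (suc m) (λ j _ → term-pascal m x j)) ⟩
      t₀ + Σ[≤ suc m ] (λ j → - x * term m x j + term (suc m) x (suc j))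
        ≈⟨ +-congˡ (sumTo-+ (suc m) _ _) ⟩
      t₀ + (Σ[≤ suc m ] (λ j → - x * term m x j) + Σ[≤ suc m ] (λ j → term (suc m) x (suc j)))
        ≈⟨ +-congˡ (+-cong (sumTo-*ˡ (suc m) (- x) (term m x)) (sumTo-last≈0 m _ (term-last≈0 (suc m) x))) ⟩
      t₀ + (- x * Σ[≤ suc m ] (term m x) + Σ[≤ m ] (λ j → term (suc m) x (suc j)))
        ≈⟨ +-congˡ (+-congʳ (*-congˡ (sumTo-last≈0 m _ (term-last≈0 m x)))) ⟩
      t₀ + (- x * E m x + Σ[≤ m ] (λ j → term (suc m) x (suc j)))
        ≈⟨ solve 4 (λ t x e s → t :+ (:- x :* e :+ s) := con (+ 1) :* (t :+ s) :- x :* e) refl t₀ x (E m x) _ ⟩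
      1# * (t₀ + Σ[≤ m ] (λ j → term (suc m) x (suc j))) - x * E m x
        ≈⟨ +-congʳ (*-congˡ (sumTo-suc m _)) ⟨
      1# * E (suc m) x - x * E m x
        ∎
      where
      -- also the constant term of E (suc m) x: both binomials reduce to 1
      t₀ = term (suc (suc m)) x 0

  D[1+m,2]≈E[m] : ∀ m x → D F (suc m) 2 x ≈ E m x
  D[1+m,2]≈E[m] m x = begin
    D F (suc m) 2 x
      ≈⟨ sumTo-cong ⌊ suc m /2⌋ (λ i i≤ → *-congʳ (reflexive (≡.cong (ℤ→F F)
           (Dcoeff[1+m,2,i]≡[m∸i]Ci m i (i≤⌊n/2⌋⇒i+i≤n (suc m) i i≤))))) ⟩
    Σ[≤ ⌊ suc m /2⌋ ] (term m x)
      ≈⟨ sumTo-extend (term m x) (ℕ.≤⇒≤′ (ℕ.≤-pred (ℕ.⌊n/2⌋<n m)))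
           (λ i ⌊⌋<i → term≈0 m x i (ℕ.<-trans (ℕ.n<1+n m) (⌊n/2⌋<i⇒n<i+i (suc m) i ⌊⌋<i))) ⟨
    E m x
      ∎

  D[N+2,2]≈E[N+1] : ∀ N x → D F (N ℕ.+ 2) 2 x ≈ E (suc N) x
  D[N+2,2]≈E[N+1] N x = trans (reflexive (≡.cong (λ n → D F n 2 x) (ℕ.+-comm N 2))) (D[1+m,2]≈E[m] (suc N) x)

  E[2]≈1-x : ∀ x → E 2 x ≈ 1# - x
  E[2]≈1-x x = begin
    E 2 x                   ≈⟨ step 0 ⟩
    1# * E 1 x - x * E 0 x  ≈⟨ +-cong (*-congˡ start₁) (-‿cong (*-congˡ start₀)) ⟩
    1# * 1# - x * 1#        ≈⟨ solve 1 (λ x → con (+ 1) :* con (+ 1) :- x :* con (+ 1) := con (+ 1) :- x) refl x ⟩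
    1# - x                  ∎
    where open IsLucasU (E-isLucasU x)

module PrimeCharacteristicWithHalf {c ℓ} (R : CommutativeRing c ℓ) where
  open import Data.Nat using (suc)
  open import Data.Integer using (+_)
  open import Data.Product using (_,_)
  open import Data.Sum using (inj₁; inj₂)
  open CommutativeRing R
  open import Algebra.Properties.Semiring.Mult semiring using (_×_; ×1-homo-*)
  open import Algebra.Properties.Semiring.Exp semiring using (_^_)
  open IntegerCoefficients R using (solve; _:+_; _:*_; con; _:=_)
  open Frobenius R using (frobenius-fixes-×1; ^-fixed-inverse)
  open Powers R using (permutedByPower-^)
  open LucasSequences R using (IsLucasU; lucasU-double-root)
  open import Relation.Binary.Reasoning.Setoid setoid

  module _ {p} (p-prime : Prime p) (char-p : p × 1# ≈ 0#) {h} (h+h≈1 : h + h ≈ 1#) where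

    2*h≈1 : 2 × 1# * h ≈ 1#
    2*h≈1 = trans (solve 1 (λ h → (con (+ 1) :+ (con (+ 1) :+ con (+ 0))) :* h := h :+ h) refl h) h+h≈1

    hᵖ≈h : h ^ p ≈ h
    hᵖ≈h = ^-fixed-inverse p (frobenius-fixes-×1 p-prime char-p 2) 2*h≈1

    h^pˡ≈h : ∀ l → h ^ (p ℕ.^ l) ≈ h
    h^pˡ≈h l with permutedByPower-^ (inj₁ (hᵖ≈h , hᵖ≈h)) l
    ... | inj₁ (hᴺ≈h , _) = hᴺ≈h
    ... | inj₂ (hᴺ≈h , _) = hᴺ≈h

    p^[1+l]×1≈0 : ∀ l → (p ℕ.^ suc l) × 1# ≈ 0#
    p^[1+l]×1≈0 l = trans (×1-homo-* p (p ℕ.^ l)) (trans (*-congʳ char-p) (zeroˡ _))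

    lucasU[1,h*h][1+p^[1+l]]≈h : ∀ {s} → IsLucasU 1# (h * h) s → ∀ l → s (suc (p ℕ.^ suc l)) ≈ h
    lucasU[1,h*h][1+p^[1+l]]≈h {s} lucas l = begin
      s (suc N)                            ≈⟨ lucasU-double-root lucas (sym h+h≈1) refl (suc N) ⟩
      (1# + (1# + N × 1#)) * (h * h ^ N)   ≈⟨ *-congʳ (+-congˡ (+-congˡ (p^[1+l]×1≈0 l))) ⟩
      2 × 1# * (h * h ^ N)                 ≈⟨ *-assoc _ h _ ⟨
      2 × 1# * h * h ^ N                   ≈⟨ *-congʳ 2*h≈1 ⟩
      1# * h ^ N                           ≈⟨ *-identityˡ _ ⟩
      h ^ N                                ≈⟨ h^pˡ≈h (suc l) ⟩
      h                                    ∎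
      where N = p ℕ.^ suc l

module OddCharacteristicWithHalf {c ℓ} (R : CommutativeRing c ℓ) where
  open import Data.Nat using (suc)
  open import Data.Integer using (+_)
  open import Data.Product using (_,_; proj₁)
  open import Data.Sum using (_⊎_; inj₁; inj₂)
  import Relation.Binary.PropositionalEquality as ≡
  open Parity using (odd-prime)
  private
    module R = CommutativeRing R
  open GaussianExtension R using (R[i]; i; embed; embed-+; embed-^; embed-×1; embed-isLucasU; i²≈-1)
  open CommutativeRing R[i]
  open import Algebra.Properties.Semiring.Mult semiring using (_×_)
  open import Algebra.Properties.Semiring.Exp semiring using (_^_)
  open import Algebra.Properties.CommutativeSemiring.Exp commutativeSemiring using (^-distrib-*)
  open import Algebra.Properties.Ring ring using (-‿distribʳ-*)
  open IntegerCoefficients R[i] using (solve; _:+_; _:*_; _:-_; :-_; con; _:=_)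
  open Frobenius R[i] using (frobenius-conjugates)
  open Powers R[i] using (PermutedByPower; permutedByPower-^; u²≈-1⇒u^odd≈±u)
  open LucasSequences using (IsLucasU; lucasU-binet)
  open import Relation.Binary.Reasoning.Setoid setoid

  module _ {p} (p-prime : Prime p) (p≢2 : ¬ p ≡ 2) (char-p : Mult._×_ R.semiring p R.1# R.≈ R.0#)
           {h} (h+h≈1 : h R.+ h R.≈ R.1#) where
    open PrimeCharacteristicWithHalf R using (hᵖ≈h)

    -- y and z are the roots (1 ± i)/2 of X² - X + 1/2.
    a b y z : Carrier
    a = embed h
    b = a * i
    y = a + b
    z = a - b

    char-pᵢ : p × 1# ≈ 0#
    char-pᵢ = trans (sym (embed-×1 p)) (char-p , R.refl)

    aᵖ≈a : a ^ p ≈ a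
    aᵖ≈a = trans (sym (embed-^ h p)) (hᵖ≈h p-prime char-p h+h≈1 , R.refl)

    iᵖ≈±i : i ^ p ≈ i ⊎ i ^ p ≈ - i
    iᵖ≈±i with odd-prime p-prime p≢2
    ... | r , p≡2r+1 = ≡.subst (λ n → i ^ n ≈ i ⊎ i ^ n ≈ - i) (≡.sym p≡2r+1) (u²≈-1⇒u^odd≈±u i²≈-1 r)

    bᵖ≈a*iᵖ : b ^ p ≈ a * i ^ p
    bᵖ≈a*iᵖ = trans (^-distrib-* a i p) (*-congʳ aᵖ≈a)

    bᵖ≈±b : b ^ p ≈ b ⊎ b ^ p ≈ - b
    bᵖ≈±b with iᵖ≈±i
    ... | inj₁ iᵖ≈i  = inj₁ (trans bᵖ≈a*iᵖ (*-congˡ iᵖ≈i))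
    ... | inj₂ iᵖ≈-i = inj₂ (trans bᵖ≈a*iᵖ (trans (*-congˡ iᵖ≈-i) (sym (-‿distribʳ-* a i))))

    a+a≈1 : a + a ≈ 1#
    a+a≈1 = trans (sym (embed-+ h h)) (h+h≈1 , R.refl)

    y+z≈1 : y + z ≈ 1#
    y+z≈1 = trans (solve 2 (λ a i → (a :+ a :* i) :+ (a :- a :* i) := a :+ a) refl a i) a+a≈1

    y*z≈a : y * z ≈ a
    y*z≈a = begin
      y * z
        ≈⟨ solve 2 (λ a i → (a :+ a :* i) :* (a :- a :* i) := (a :+ a) :* a :- a :* a :* (con (+ 1) :+ i :* i)) refl a i ⟩
      (a + a) * a - a * a * (1# + i * i)
        ≈⟨ +-cong (*-congʳ a+a≈1) (-‿cong (*-congˡ (+-congˡ i²≈-1))) ⟩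
      1# * a - a * a * (1# - 1#)
        ≈⟨ solve 1 (λ a → con (+ 1) :* a :- a :* a :* (con (+ 1) :- con (+ 1)) := a) refl a ⟩
      a
        ∎

    y*z+y*z≈1 : y * z + y * z ≈ 1#
    y*z+y*z≈1 = trans (+-cong y*z≈a y*z≈a) a+a≈1

    y-z≈i : y - z ≈ i
    y-z≈i = begin
      y - z         ≈⟨ solve 2 (λ a i → (a :+ a :* i) :- (a :- a :* i) := (a :+ a) :* i) refl a i ⟩
      (a + a) * i   ≈⟨ *-congʳ a+a≈1 ⟩
      1# * i        ≈⟨ *-identityˡ i ⟩
      i             ∎

    [-i]*[y-z]≈1 : - i * (y - z) ≈ 1#
    [-i]*[y-z]≈1 = begin
      - i * (y - z)   ≈⟨ *-congˡ y-z≈i ⟩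
      - i * i         ≈⟨ solve 1 (λ i → :- i :* i := :- (i :* i)) refl i ⟩
      - (i * i)       ≈⟨ -‿cong i²≈-1 ⟩
      - (- 1#)        ≈⟨ solve 0 (:- (:- con (+ 1)) := con (+ 1)) refl ⟩
      1#              ∎

    [y-z]*-cancel : ∀ {u v} → (y - z) * u ≈ (y - z) * v → u ≈ v
    [y-z]*-cancel {u} {v} [y-z]u≈[y-z]v = begin
      u                    ≈⟨ *-identityˡ u ⟨
      1# * u               ≈⟨ *-congʳ [-i]*[y-z]≈1 ⟨
      - i * (y - z) * u    ≈⟨ *-assoc _ _ u ⟩
      - i * ((y - z) * u)  ≈⟨ *-congˡ [y-z]u≈[y-z]v ⟩
      - i * ((y - z) * v)  ≈⟨ *-assoc _ _ v ⟨
      - i * (y - z) * v    ≈⟨ *-congʳ [-i]*[y-z]≈1 ⟩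
      1# * v               ≈⟨ *-identityˡ v ⟩
      v                    ∎

    y,z-permutedBy-pˡ : ∀ l → PermutedByPower (p ℕ.^ l) y z
    y,z-permutedBy-pˡ = permutedByPower-^ {M = p} (frobenius-conjugates p-prime char-pᵢ aᵖ≈a bᵖ≈±b)

    y^[N+2]-z^[N+2]≈[y-z]*y*z : ∀ N → PermutedByPower N y z →
                                y ^ suc (suc N) - z ^ suc (suc N) ≈ (y - z) * (y * z)
    y^[N+2]-z^[N+2]≈[y-z]*y*z N (inj₁ (yᴺ≈y , zᴺ≈z)) = begin
      y * (y * y ^ N) - z * (z * z ^ N)
        ≈⟨ +-cong (*-congˡ (*-congˡ yᴺ≈y)) (-‿cong (*-congˡ (*-congˡ zᴺ≈z))) ⟩
      y * (y * y) - z * (z * z)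
        ≈⟨ solve 2 (λ y z → y :* (y :* y) :- z :* (z :* z)
                         := (y :- z) :* (y :* z) :+ (y :- z) :* ((y :+ z) :* (y :+ z) :- (y :* z :+ y :* z))) refl y z ⟩
      (y - z) * (y * z) + (y - z) * ((y + z) * (y + z) - (y * z + y * z))
        ≈⟨ +-congˡ (*-congˡ (+-cong (*-cong y+z≈1 y+z≈1) (-‿cong y*z+y*z≈1))) ⟩
      (y - z) * (y * z) + (y - z) * (1# * 1# - 1#)
        ≈⟨ solve 2 (λ W D → W :+ D :* (con (+ 1) :* con (+ 1) :- con (+ 1)) := W) refl _ _ ⟩
      (y - z) * (y * z)
        ∎
    y^[N+2]-z^[N+2]≈[y-z]*y*z N (inj₂ (yᴺ≈z , zᴺ≈y)) = begin
      y * (y * y ^ N) - z * (z * z ^ N)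
        ≈⟨ +-cong (*-congˡ (*-congˡ yᴺ≈z)) (-‿cong (*-congˡ (*-congˡ zᴺ≈y))) ⟩
      y * (y * z) - z * (z * y)
        ≈⟨ solve 2 (λ y z → y :* (y :* z) :- z :* (z :* y) := (y :- z) :* (y :* z)) refl y z ⟩
      (y - z) * (y * z)
        ∎

    lucasU[1,h][1+pˡ]≈h : ∀ {s} → IsLucasU R R.1# h s → ∀ l → s (suc (p ℕ.^ l)) R.≈ h
    lucasU[1,h][1+pˡ]≈h {s} lucas l = proj₁ (begin
      embed (s (suc N))  ≈⟨ [y-z]*-cancel (trans binet (y^[N+2]-z^[N+2]≈[y-z]*y*z N (y,z-permutedBy-pˡ l))) ⟩
      y * z              ≈⟨ y*z≈a ⟩
      a                  ∎)
      where
      N = p ℕ.^ l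
      binet : (y - z) * embed (s (suc N)) ≈ y ^ suc (suc N) - z ^ suc (suc N)
      binet = lucasU-binet R[i] (embed-isLucasU lucas) (sym y+z≈1) (sym y*z≈a) (suc N)

module PermutationPolynomials {c ℓ q} (F : FiniteField c ℓ q) where
  open FiniteField F
  open import Data.Product using (_,_)
  open import Function.Consequences.Setoid setoid setoid using (inverseᵇ⇒bijective)
  open IntegerCoefficients cring using (solve; _:-_; con; _:=_)
  open import Data.Integer using (+_)
  open DicksonSecondKind F using (D[N+2,2]≈E[N+1]; E[2]≈1-x)

  isPermutationPolynomial-cong : ∀ {f g} → (∀ x → f x ≈ g x) → IsPermutationPolynomial F f → IsPermutationPolynomial F g
  isPermutationPolynomial-cong {f} {g} f≈g (injective , surjective) =
      (λ {x} {y} gx≈gy → injective (trans (f≈g x) (trans gx≈gy (sym (f≈g y)))))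
    , (λ y → let (x , fx≈y) = surjective y in x , λ z≈x → trans (sym (f≈g _)) (fx≈y z≈x))

  1-x-isPermutationPolynomial : IsPermutationPolynomial F (λ x → 1# - x)
  1-x-isPermutationPolynomial = inverseᵇ⇒bijective (involution , involution)
    where
    involution : ∀ {x y} → y ≈ 1# - x → 1# - y ≈ x
    involution {x} y≈1-x = trans (+-congˡ (-‿cong y≈1-x)) (solve 1 (λ x → con (+ 1) :- (con (+ 1) :- x) := x) refl x)

  D[3,2]-isPermutationPolynomial : IsPermutationPolynomial F (D F 3 2)
  D[3,2]-isPermutationPolynomial = isPermutationPolynomial-cong
    (λ x → sym (trans (D[N+2,2]≈E[N+1] 1 x) (E[2]≈1-x x))) 1-x-isPermutationPolynomial

module OddPrimePowerField {c ℓ p e} (p-prime : Prime p) (p≢2 : ¬ p ≡ 2)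
                          (F : FiniteField c ℓ (p ℕ.^ ℕ.suc e)) where
  open import Data.Nat using (suc)
  open import Data.Integer using (+_)
  open import Data.Product using (_,_; proj₁; proj₂)
  import Relation.Binary.PropositionalEquality as ≡
  open FiniteField F
  open import Algebra.Properties.Semiring.Mult semiring using (_×_; ×1-homo-*)
  open import Algebra.Properties.Ring ring using (x+x≈x⇒x≈0)
  open IntegerCoefficients cring using (solve; _:+_; _:*_; con; _:=_)
  open FiniteFieldProperties F using (characteristic)
  open DicksonSecondKind F using (E; E-isLucasU; D[N+2,2]≈E[N+1])
  open PrimeCharacteristicWithHalf cring using (lucasU[1,h*h][1+p^[1+l]]≈h)
  open OddCharacteristicWithHalf cring using (lucasU[1,h][1+pˡ]≈h)
  open Parity using (odd-prime; r+r≡r*2)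
  open import Relation.Binary.Reasoning.Setoid setoid

  r : ℕ.ℕ
  r = proj₁ (odd-prime p-prime p≢2)

  p≡2r+1 : p ≡ suc (r ℕ.+ r)
  p≡2r+1 = proj₂ (odd-prime p-prime p≢2)

  char-p : p × 1# ≈ 0#
  char-p = characteristic {p} {e} ≡.refl

  2≉0 : ¬ 2 × 1# ≈ 0#
  2≉0 2≈0 = 1≉0 (begin
    1#                     ≈⟨ +-identityʳ 1# ⟨
    1# + 0#                ≈⟨ +-congˡ [r+r]×1≈0 ⟨
    1# + (r ℕ.+ r) × 1#    ≡⟨ ≡.cong (_× 1#) p≡2r+1 ⟨
    p × 1#                 ≈⟨ char-p ⟩
    0#                     ∎)
    where
    [r+r]×1≈0 : (r ℕ.+ r) × 1# ≈ 0#
    [r+r]×1≈0 = begin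
      (r ℕ.+ r) × 1#         ≡⟨ ≡.cong (_× 1#) (r+r≡r*2 r) ⟩
      (r ℕ.* 2) × 1#         ≈⟨ ×1-homo-* r 2 ⟩
      r × 1# * 2 × 1#        ≈⟨ *-congˡ 2≈0 ⟩
      r × 1# * 0#            ≈⟨ zeroʳ _ ⟩
      0#                     ∎

  h : Carrier
  h = proj₁ (inverse (2 × 1#) 2≉0)

  2*h≈1 : 2 × 1# * h ≈ 1#
  2*h≈1 = proj₂ (inverse (2 × 1#) 2≉0)

  h+h≈1 : h + h ≈ 1#
  h+h≈1 = trans (solve 1 (λ h → h :+ h := (con (+ 1) :+ (con (+ 1) :+ con (+ 0))) :* h) refl h) 2*h≈1

  h*h≉h : ¬ h * h ≈ h
  h*h≉h h*h≈h = 1≉0 (x+x≈x⇒x≈0 1# (trans (+-cong (sym h≈1) (sym h≈1)) h+h≈1))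
    where
    h≈1 : h ≈ 1#
    h≈1 = begin
      h                ≈⟨ *-identityˡ h ⟨
      1# * h           ≈⟨ *-congʳ 2*h≈1 ⟨
      2 × 1# * h * h   ≈⟨ *-assoc _ h h ⟩
      2 × 1# * (h * h) ≈⟨ *-congˡ h*h≈h ⟩
      2 × 1# * h       ≈⟨ 2*h≈1 ⟩
      1#               ∎

  D[p^[1+l]+2,2]-not-permutation : ∀ l → ¬ IsPermutationPolynomial F (D F (p ℕ.^ suc l ℕ.+ 2) 2)
  D[p^[1+l]+2,2]-not-permutation l (injective , _) = h*h≉h (injective (begin
    D F (N ℕ.+ 2) 2 (h * h)  ≈⟨ D[N+2,2]≈E[N+1] N (h * h) ⟩
    E (suc N) (h * h)        ≈⟨ lucasU[1,h*h][1+p^[1+l]]≈h p-prime char-p h+h≈1 (E-isLucasU (h * h)) l ⟩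
    h                        ≈⟨ lucasU[1,h][1+pˡ]≈h p-prime p≢2 char-p h+h≈1 (E-isLucasU h) (suc l) ⟨
    E (suc N) h              ≈⟨ D[N+2,2]≈E[N+1] N h ⟨
    D F (N ℕ.+ 2) 2 h        ∎))
    where N = p ℕ.^ suc l

open import Level using (Level)
open import Data.Nat using (ℕ; zero; suc; s≤s; z≤n; _+_; _^_; _≥_)
open import Data.Empty using (⊥-elim)
open import Function.Bundles using (_⇔_; mk⇔)
open import Relation.Binary.PropositionalEquality using (refl)

theorem2p15 : {c ℓ : Level} (p e : ℕ) → Prime p → ¬ (p ≡ 2) → e ≥ 1 →
    (F : FiniteField c ℓ (p ^ e)) → (l : ℕ) →
    IsPermutationPolynomial F (D F (p ^ l + 2) 2) ⇔ (l ≡ 0)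
theorem2p15 p (suc e) p-prime p≢2 (s≤s z≤n) F l = mk⇔ (permutation⇒l≡0 l) l≡0⇒permutation
  where
  permutation⇒l≡0 : ∀ l → IsPermutationPolynomial F (D F (p ^ l + 2) 2) → l ≡ 0
  permutation⇒l≡0 zero    _           = refl
  permutation⇒l≡0 (suc l) permutation =
    ⊥-elim (OddPrimePowerField.D[p^[1+l]+2,2]-not-permutation {e = e} p-prime p≢2 F l permutation)
  l≡0⇒permutation : l ≡ 0 → IsPermutationPolynomial F (D F (p ^ l + 2) 2)
  l≡0⇒permutation refl = PermutationPolynomials.D[3,2]-isPermutationPolynomial F
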